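{- For every graph $G$, $w(G)\le s(G)\le \tau(G)$, where $w(G)$ is the unigraph number, $s(G)$ the strong unigraph number, and $\tau(G)$ the vertex cover number of $G$.
   Context: All graphs are finite, undirected, simple and connected. A $k$-edge coloring of $G$ is any function $c:E(G)\to[k]$, $[k]=\{1,\dots,k\}$ (not necessarily proper); $G^c$ denotes $G$ with coloring $c$. For $i\in[k]$, the color-$i$ subgraph is the edge-induced subgraph $G[\{e: c(e)=i\}]$. The degree set of a graph is the multiset of its vertex degrees; a graph $G$ is a unigraph if every graph with the same degree set is isomorphic to $G$. A $k$-unigraphic coloring is a $k$-edge coloring whose every color-$i$ subgraph is a connected unigraph. The colored degree of $v$ is $(\deg_{G^c}(v,1),\dots,\deg_{G^c}(v,k))$ with $\deg_{G^c}(v,i)$ the number of color-$i$ edges at $v$, and $D(G^c)$ is the multiset of colored degrees of all vertices. A $k$-edge coloring $c$ is $k$-strongly unigraphic if it is $k$-unigraphic and for every graph $H$, the existence of $c':E(H)\to[k]$ with $D(G^c)=D(H^{c'})$ implies $G\cong H$. $G$ is a $k$-unigraph (resp. $k$-strong unigraph) if it has a $k$-unigraphic (resp. $k$-strongly unigraphic) coloring; $w(G)$ (resp. $s(G)$) is the minimum such $k$. A vertex cover is a set $U\subseteq V(G)$ meeting every edge; $\tau(G)$ is the minimum size of a vertex cover. -}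

module Defs where

open import Data.Nat using (ℕ; _≤_; _<_)
open import Data.Bool using (Bool; true; false; T; _∧_)
open import Data.Unit using (tt)
open import Data.Fin using (Fin; _≟_)
open import Data.Fin.Subset using (Subset; _∈_; ∣_∣)
open import Data.List using (List; length; filterᵇ; allFin; lookup)
open import Data.Bool.ListAction using (any)
open import Data.Product using (Σ; _×_; _,_)
open import Data.Sum using (_⊎_)
open import Function.Bundles using (_↔_; Inverse)
open import Relation.Nullary.Decidable using (⌊_⌋)
open import Relation.Binary.PropositionalEquality using (_≡_)

record Graph : Set where
  constructor mkGraph
  field
    n   : ℕ
    adj : Fin n → Fin n → Bool
open Graph public

SimpleGraph : Graph → Set
SimpleGraph G = (∀ u v → adj G u v ≡ adj G v u) × (∀ v → adj G v v ≡ false)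

data Reach (G : Graph) : Fin (n G) → Fin (n G) → Set where
  here : ∀ {u} → Reach G u u
  step : ∀ {u w v} → adj G u w ≡ true → Reach G w v → Reach G u v

Connected : Graph → Set
Connected G = (0 < n G) × (∀ u v → Reach G u v)

count : ∀ {m} → (Fin m → Bool) → ℕ
count {m} p = length (filterᵇ p (allFin m))

deg : (G : Graph) → Fin (n G) → ℕ
deg G v = count (adj G v)

Iso : Graph → Graph → Set
Iso G H = Σ (Fin (n G) ↔ Fin (n H)) λ σ →
  ∀ u v → adj H (Inverse.to σ u) (Inverse.to σ v) ≡ adj G u v

-- same degree set (equal multisets of vertex degrees)
SameDegrees : Graph → Graph → Set
SameDegrees G H = Σ (Fin (n G) ↔ Fin (n H)) λ σ →
  ∀ v → deg H (Inverse.to σ v) ≡ deg G v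

Unigraph : Graph → Set
Unigraph G = ∀ H → SimpleGraph H → SameDegrees G H → Iso G H

record Coloring (G : Graph) (k : ℕ) : Set where
  constructor mkColoring
  field
    col : (u v : Fin (n G)) → T (adj G u v) → Fin k
    col-sym : ∀ u v (p : T (adj G u v)) (q : T (adj G v u)) → col u v p ≡ col v u q
open Coloring public

colHit : ∀ {k} (b : Bool) → (T b → Fin k) → Fin k → Bool
colHit false f i = false
colHit true  f i = ⌊ f tt ≟ i ⌋

cdeg : ∀ {k} (G : Graph) → Coloring G k → Fin (n G) → Fin k → ℕ
cdeg G c v i = count (λ u → colHit (adj G v u) (col c v u) i)

colVerts : ∀ {k} (G : Graph) → Coloring G k → Fin k → List (Fin (n G))
colVerts G c i = filterᵇ (λ v → any (λ u → colHit (adj G v u) (col c v u) i) (allFin (n G))) (allFin (n G))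

-- the colour-i subgraph: edge-induced subgraph G[{e : c(e) = i}]
colorSubgraph : ∀ {k} (G : Graph) → Coloring G k → Fin k → Graph
colorSubgraph G c i = mkGraph (length vs) (λ a b → colHit (adj G (f a) (f b)) (col c (f a) (f b)) i)
  where
  vs = colVerts G c i
  f = lookup vs

Unigraphic : ∀ {k} (G : Graph) → Coloring G k → Set
Unigraphic G c = ∀ i → Connected (colorSubgraph G c i) × Unigraph (colorSubgraph G c i)

SameColDegrees : ∀ {k} (G : Graph) → Coloring G k → (H : Graph) → Coloring H k → Set
SameColDegrees G c H c' = Σ (Fin (n G) ↔ Fin (n H)) λ σ →
  ∀ v i → cdeg H c' (Inverse.to σ v) i ≡ cdeg G c v i

StronglyUnigraphic : ∀ {k} (G : Graph) → Coloring G k → Set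
StronglyUnigraphic {k} G c = Unigraphic G c ×
  (∀ H → SimpleGraph H → (c' : Coloring H k) → SameColDegrees G c H c' → Iso G H)

IsKUnigraph : Graph → ℕ → Set
IsKUnigraph G k = Σ (Coloring G k) λ c → Unigraphic G c

IsKStrongUnigraph : Graph → ℕ → Set
IsKStrongUnigraph G k = Σ (Coloring G k) λ c → StronglyUnigraphic G c

VertexCover : (G : Graph) → Subset (n G) → Set
VertexCover G U = ∀ u v → adj G u v ≡ true → u ∈ U ⊎ v ∈ U

HasVertexCoverOfSize : Graph → ℕ → Set
HasVertexCoverOfSize G t = Σ (Subset (n G)) λ U → VertexCover G U × ∣ U ∣ ≡ t

IsMinimum : (ℕ → Set) → ℕ → Set
IsMinimum P m = P m × (∀ k → P k → m ≤ k)

module Submission where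

-- Key construction (module StarColouring): enumerate a smallest vertex cover U
-- as c₀ < c₁ < … and give each edge the index of its endpoint in U (the
-- smaller one if both lie in U).  Colour class j is a star centred at c_j,
-- with a leaf since by minimality c_j has a neighbour outside U.  A star is
-- determined by its degrees (star-rigid), so each class is a connected
-- unigraph and a graph with the same coloured degrees has the same classes,
-- i.e. is G: the colouring is τ-strongly unigraphic, hence also unigraphic.
-- The minima exist constructively because everything is decidable: all
-- quantifiers range over exhaustible types (bijections, adjacency matrices,
-- colourings on Fin m, after relabelling arbitrary graphs), and reachability
-- is a fixed-point iteration.

open import Defs
open import Level using (0ℓ)
open import Data.Nat using (ℕ; zero; suc; _+_; _≤_; _<_; _<?_; z≤n; s≤s)
open import Data.Nat.Properties
  using (+-mono-≤; +-mono-≤-<; <-irrefl; ≤-trans; m≤n⇒m≤1+n; 1+n≰n; ≮⇒≥; n<1+n; m<1+n⇒m<n∨m≡n)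
import Data.Nat.Properties as ℕ
open import Data.Bool using (Bool; true; false; T; T?)
open import Data.Bool.Properties using (T-≡; T-irrelevant; ⇔→≡)
import Data.Bool.Properties as Bool
open import Data.Bool.ListAction using (any; or)
open import Data.Unit using (tt)
open import Data.Empty using (⊥-elim)
open import Data.Fin using (Fin; zero; suc; _≟_; fromℕ<)
import Data.Fin.Properties as Fin
open import Data.Fin.Subset using (Subset; _∈_; _∉_; ∣_∣; ⊤; _-_; inside; outside)
open import Data.Fin.Subset.Properties
  using (_∈?_; anySubset?; ∈⊤; ∣⊤∣≡n; x∈p∧x≢y⇒x∈p-y; x∈p⇒∣p-x∣<∣p∣)
open import Data.Vec using ([]; _∷_)
open import Data.List using (List; length; lookup; filter; tabulate; allFin)
open import Data.List.Properties using (filter-≐; map-cong)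
open import Data.List.Membership.Propositional using (lose)
open import Data.List.Membership.Propositional.Properties using (∈-filter⁺; ∈-filter⁻; ∈-allFin; ∈-lookup)
open import Data.List.Relation.Unary.All as All using ()
open import Data.List.Relation.Unary.Any as Any using (satisfied)
open import Data.List.Relation.Unary.Any.Properties using (lookup-index; any⁺; any⁻)
open import Data.List.Relation.Unary.AllPairs using (_∷_)
open import Data.List.Relation.Unary.Unique.Propositional using (Unique)
import Data.List.Relation.Unary.Unique.Propositional.Properties as Unique
open import Data.Product using (Σ; ∃; _×_; _,_; proj₁; proj₂)
open import Data.Sum using (_⊎_; inj₁; inj₂)
import Data.Sum as Sum
open import Function using (_∘_; id)
open import Function.Bundles using (_↔_; Inverse; Equivalence; mk↔ₛ′; mk⇔)
open import Function.Definitions using (Injective)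
open import Function.Properties.Inverse using (↔-refl; ↔-sym; ↔-trans)
open import Relation.Nullary using (¬_; Dec; does; yes; no; ¬?; _×-dec_; _⊎-dec_; _→-dec_)
open import Relation.Nullary.Decidable using (⌊_⌋; map′; dec-true; decidable-stable; does-⇔; isYes≗does)
open import Relation.Unary using (Pred; Decidable)
import Relation.Unary
open import Relation.Binary using (Rel; Reflexive; Symmetric; _Respects_)
open import Relation.Binary.PropositionalEquality
import Algebra.Properties.CommutativeMonoid.Sum as MonoidSum
import Algebra.Construct.NaturalChoice.Min as Min

b2n : Bool → ℕ
b2n true  = 1
b2n false = 0

card : ∀ {m} → (Fin m → Bool) → ℕ
card {zero}  p = 0
card {suc m} p = b2n (p zero) + card (p ∘ suc)

length-filter-tabulate : ∀ {A : Set} {m} {P : Pred A 0ℓ} (P? : Decidable P) (f : Fin m → A) →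
  length (filter P? (tabulate f)) ≡ card (λ i → does (P? (f i)))
length-filter-tabulate {m = zero}  P? f = refl
length-filter-tabulate {m = suc m} P? f with does (P? (f zero))
... | true  = cong suc (length-filter-tabulate P? (f ∘ suc))
... | false = length-filter-tabulate P? (f ∘ suc)

count≡card : ∀ {m} (p : Fin m → Bool) → count p ≡ card p
count≡card p = length-filter-tabulate (T? ∘ p) id

∣∣≡card : ∀ {m} (U : Subset m) → ∣ U ∣ ≡ card (λ x → does (x ∈? U))
∣∣≡card []            = refl
∣∣≡card (inside ∷ U)  = cong suc (∣∣≡card U)
∣∣≡card (outside ∷ U) = ∣∣≡card U

true≢false : true ≢ false
true≢false ()

_⊆ᵇ_ : ∀ {m} → (Fin m → Bool) → (Fin m → Bool) → Set
p ⊆ᵇ q = ∀ i → p i ≡ true → q i ≡ true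

single : ∀ {m} → Fin m → Fin m → Bool
single x i = ⌊ i ≟ x ⌋

single-self : ∀ {m} (x : Fin m) → single x x ≡ true
single-self x with x ≟ x
... | yes _  = refl
... | no x≢x = ⊥-elim (x≢x refl)

single⇒≡ : ∀ {m} {x i : Fin m} → single x i ≡ true → i ≡ x
single⇒≡ {x = x} {i} e with i ≟ x
... | yes i≡x = i≡x

single-⊆ : ∀ {m} {p : Fin m → Bool} {x} → p x ≡ true → single x ⊆ᵇ p
single-⊆ px i e rewrite single⇒≡ e = px

card-cong : ∀ {m} {p q : Fin m → Bool} → (∀ i → p i ≡ q i) → card p ≡ card q
card-cong {zero}  e = refl
card-cong {suc m} e = cong₂ _+_ (cong b2n (e zero)) (card-cong (e ∘ suc))

count-cong : ∀ {m} {p q : Fin m → Bool} → (∀ i → p i ≡ q i) → count p ≡ count q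
count-cong {p = p} {q} e = trans (count≡card p) (trans (card-cong e) (sym (count≡card q)))

card-≤ : ∀ {m} (p : Fin m → Bool) → card p ≤ m
card-≤ {zero}  p = z≤n
card-≤ {suc m} p with p zero
... | true  = s≤s (card-≤ (p ∘ suc))
... | false = m≤n⇒m≤1+n (card-≤ (p ∘ suc))

card-false : ∀ {m} (p : Fin m → Bool) → (∀ i → p i ≡ false) → card p ≡ 0
card-false {zero}  p h = refl
card-false {suc m} p h rewrite h zero = card-false (p ∘ suc) (h ∘ suc)

card-single : ∀ {m} (x : Fin m) → card (single x) ≡ 1
card-single {suc m} zero    = cong suc (card-false {m} _ (λ _ → refl))
card-single {suc m} (suc x) = trans (card-cong single-suc) (card-single x)
  where
  single-suc : ∀ i → single (suc x) (suc i) ≡ single x i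
  single-suc i with i ≟ x
  ... | yes _ = refl
  ... | no  _ = refl

b2n-mono : ∀ {a b} → (a ≡ true → b ≡ true) → b2n a ≤ b2n b
b2n-mono {false}     _ = z≤n
b2n-mono {true}  {b} h rewrite h refl = s≤s z≤n

card-mono : ∀ {m} {p q : Fin m → Bool} → p ⊆ᵇ q → card p ≤ card q
card-mono {zero}  h = z≤n
card-mono {suc m} h = +-mono-≤ (b2n-mono (h zero)) (card-mono (h ∘ suc))

card-strict : ∀ {m} {p q : Fin m → Bool} → p ⊆ᵇ q →
  ∀ w → p w ≡ false → q w ≡ true → card p < card q
card-strict {suc m} {p} {q} h zero    pw qw rewrite pw | qw = s≤s (card-mono (h ∘ suc))
card-strict {suc m} {p} {q} h (suc w) pw qw =
  +-mono-≤-< (b2n-mono (h zero)) (card-strict (h ∘ suc) w pw qw)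

card-⊆-≡ : ∀ {m} {p q : Fin m → Bool} → p ⊆ᵇ q → card p ≡ card q → q ⊆ᵇ p
card-⊆-≡ {p = p} h e i qi with p i in pi
... | true  = refl
... | false = ⊥-elim (<-irrefl e (card-strict h i pi qi))

card-0⇒false : ∀ {m} (p : Fin m → Bool) → card p ≡ 0 → ∀ i → p i ≡ false
card-0⇒false {m} p e i with p i in pi
... | false = refl
... | true  = ⊥-elim (<-irrefl (trans (card-false {m} _ (λ _ → refl)) (sym e))
                               (card-strict {p = λ _ → false} (λ _ ()) i refl pi))

card-1-unique : ∀ {m} (p : Fin m → Bool) → card p ≡ 1 → ∀ {x y} → p x ≡ true → p y ≡ true → y ≡ x
card-1-unique p e {x} {y} px py =
  single⇒≡ (card-⊆-≡ (single-⊆ px) (trans (card-single x) (sym e)) y py)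

module ℕSum = MonoidSum ℕ.+-0-commutativeMonoid

card≡sum : ∀ {m} (p : Fin m → Bool) → card p ≡ ℕSum.sum (b2n ∘ p)
card≡sum {zero}  p = refl
card≡sum {suc m} p = cong (b2n (p zero) +_) (card≡sum (p ∘ suc))

card-permute : ∀ {a b} (σ : Fin a ↔ Fin b) (p : Fin b → Bool) → card (p ∘ Inverse.to σ) ≡ card p
card-permute σ p = begin
  card (p ∘ Inverse.to σ)           ≡⟨ card≡sum (p ∘ Inverse.to σ) ⟩
  ℕSum.sum (b2n ∘ p ∘ Inverse.to σ) ≡⟨ ℕSum.sum-permute (b2n ∘ p) σ ⟨
  ℕSum.sum (b2n ∘ p)                ≡⟨ card≡sum p ⟨
  card p                            ∎
  where open ≡-Reasoning

Adj : ℕ → Set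
Adj m = Fin m → Fin m → Bool

_≐_ : ∀ {m} → Adj m → Adj m → Set
A ≐ B = ∀ i j → A i j ≡ B i j

≐-sym : ∀ {m} {A B : Adj m} → A ≐ B → B ≐ A
≐-sym e i j = sym (e i j)

simple-≐ : ∀ {m} {A B : Adj m} → A ≐ B → SimpleGraph (mkGraph m A) → SimpleGraph (mkGraph m B)
simple-≐ e (symm , loopless) = (λ u v → trans (sym (e u v)) (trans (symm u v) (e v u))) ,
                               (λ v → trans (sym (e v v)) (loopless v))

iso-≐ : ∀ {m} {A B : Adj m} → A ≐ B → Iso (mkGraph m A) (mkGraph m B)
iso-≐ e = ↔-refl , λ u v → sym (e u v)

iso-sym : ∀ {X Y} → Iso X Y → Iso Y X
iso-sym {X} {Y} (σ , h) = ↔-sym σ , λ u v →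
  trans (sym (h (Inverse.from σ u) (Inverse.from σ v)))
        (cong₂ (adj Y) (Inverse.strictlyInverseˡ σ u) (Inverse.strictlyInverseˡ σ v))

iso-trans : ∀ {X Y Z} → Iso X Y → Iso Y Z → Iso X Z
iso-trans (σ , h) (ρ , k) = ↔-trans σ ρ , λ u v → trans (k _ _) (h u v)

-- This reduces quantifiers over all graphs to
-- quantifiers over adjacency matrices on a fixed vertex set.
relabel : ∀ {m} (H : Graph) → Fin m ↔ Fin (n H) → Graph
relabel {m} H σ = mkGraph m (λ a b → adj H (Inverse.to σ a) (Inverse.to σ b))

relabel-iso : ∀ {m} (H : Graph) (σ : Fin m ↔ Fin (n H)) → Iso (relabel H σ) H
relabel-iso H σ = σ , λ _ _ → refl

relabel-simple : ∀ {m} (H : Graph) (σ : Fin m ↔ Fin (n H)) → SimpleGraph H → SimpleGraph (relabel H σ)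
relabel-simple H σ (symm , loopless) = (λ _ _ → symm _ _) , (λ _ → loopless _)

inhabited⇒positive : ∀ {k} → Fin k → 0 < k
inhabited⇒positive zero    = s≤s z≤n
inhabited⇒positive (suc _) = s≤s z≤n

deg-iso : ∀ {X Y} ((σ , _) : Iso X Y) → ∀ v → deg Y (Inverse.to σ v) ≡ deg X v
deg-iso {X} {Y} (σ , h) v = begin
  deg Y (Inverse.to σ v)                       ≡⟨ count≡card (adj Y (Inverse.to σ v)) ⟩
  card (adj Y (Inverse.to σ v))                ≡⟨ card-permute σ _ ⟨
  card (adj Y (Inverse.to σ v) ∘ Inverse.to σ) ≡⟨ card-cong (h v) ⟩
  card (adj X v)                               ≡⟨ count≡card (adj X v) ⟨
  deg X v                                      ∎
  where open ≡-Reasoning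

reach-iso : ∀ {X Y} ((σ , _) : Iso X Y) → ∀ {u v} →
  Reach X u v → Reach Y (Inverse.to σ u) (Inverse.to σ v)
reach-iso i       here       = here
reach-iso (σ , h) (step e r) = step (trans (h _ _) e) (reach-iso (σ , h) r)

connected-iso : ∀ {X Y} → Iso X Y → Connected X → Connected Y
connected-iso {X} {Y} (σ , h) (nonempty , reach) =
  inhabited⇒positive (Inverse.to σ (fromℕ< nonempty)) , λ u v →
  subst₂ (Reach Y) (Inverse.strictlyInverseˡ σ u) (Inverse.strictlyInverseˡ σ v)
    (reach-iso (σ , h) (reach (Inverse.from σ u) (Inverse.from σ v)))

unigraph-iso : ∀ {X Y} → Iso X Y → Unigraph X → Unigraph Y
unigraph-iso {X} {Y} i uX H simpleH (ρ , dρ) =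
  iso-trans {Y} {X} {H} (iso-sym {X} {Y} i)
    (uX H simpleH (↔-trans (proj₁ i) ρ , λ v → trans (dρ _) (deg-iso {X} {Y} i v)))

UnigraphOn : Graph → Set
UnigraphOn X = ∀ (A : Adj (n X)) → SimpleGraph (mkGraph (n X) A) →
  (∀ v → deg (mkGraph (n X) A) v ≡ deg X v) → Iso X (mkGraph (n X) A)

unigraphOn⇒unigraph : ∀ X → UnigraphOn X → Unigraph X
unigraphOn⇒unigraph X uX H simpleH (σ , dσ) =
  iso-trans {X} {relabel H σ} {H} (uX _ (relabel-simple H σ simpleH) degrees) (relabel-iso H σ)
  where
  degrees : ∀ v → deg (relabel H σ) v ≡ deg X v
  degrees v = trans (sym (deg-iso {relabel H σ} {H} (relabel-iso H σ) v)) (dσ v)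

unigraph⇒unigraphOn : ∀ X → Unigraph X → UnigraphOn X
unigraph⇒unigraphOn X uX A simpleA dA = uX (mkGraph (n X) A) simpleA (↔-refl , dA)

Exhaustible : (A : Set) → Rel A 0ℓ → Set₁
Exhaustible A _≈_ = (P : Pred A 0ℓ) → Decidable P → P Respects _≈_ → Dec (∃ P)

exhaustible-Fin : ∀ {k} → Exhaustible (Fin k) _≡_
exhaustible-Fin P P? _ = Fin.any? P?

exhaustible-Bool : Exhaustible Bool _≡_
exhaustible-Bool P P? _ with P? true | P? false
... | yes p | _     = yes (true , p)
... | no _  | yes q = yes (false , q)
... | no ¬p | no ¬q = no λ { (true , p) → ¬p p ; (false , q) → ¬q q }

exhaustible-T⇒ : ∀ {A : Set} b → Exhaustible A _≡_ →
  Exhaustible (T b → A) (λ f g → ∀ p → f p ≡ g p)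
exhaustible-T⇒ false _ P P? resp with P? (λ ())
... | yes p = yes (_ , p)
... | no ¬p = no λ (f , pf) → ¬p (resp (λ ()) pf)
exhaustible-T⇒ true ex P P? resp
  with ex (λ a → P (λ _ → a)) (λ a → P? (λ _ → a)) (λ { refl p → p })
... | yes (a , p) = yes (_ , p)
... | no ¬p = no λ (f , pf) → ¬p (f tt , resp (λ { tt → refl }) pf)

cons : ∀ {m} {B : Fin (suc m) → Set} → B zero → ((i : Fin m) → B (suc i)) → (i : Fin (suc m)) → B i
cons b g zero    = b
cons b g (suc i) = g i

exhaustible-Π : ∀ m {B : Fin m → Set} {R : (i : Fin m) → Rel (B i) 0ℓ} →
  (∀ i → Reflexive (R i)) → (∀ i → Exhaustible (B i) (R i)) →
  Exhaustible ((i : Fin m) → B i) (λ f g → ∀ i → R i (f i) (g i))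
exhaustible-Π zero _ _ P P? resp with P? (λ ())
... | yes p = yes (_ , p)
... | no ¬p = no λ (f , pf) → ¬p (resp (λ ()) pf)
exhaustible-Π (suc m) {B} {R} R-refl ex P P? resp
  with ex zero (λ b → ∃ λ g → P (cons b g))
         (λ b → exhaustible-Π m (R-refl ∘ suc) (ex ∘ suc) (P ∘ cons b) (P? ∘ cons b)
                  (λ e → resp λ { zero → R-refl zero ; (suc i) → e i }))
         (λ e (g , p) → g , resp (λ { zero → e ; (suc i) → R-refl (suc i) }) p)
... | yes (b , g , p) = yes (cons b g , p)
... | no ¬p = no λ (f , pf) →
  ¬p (f zero , f ∘ suc , resp (λ { zero → R-refl zero ; (suc i) → R-refl (suc i) }) pf)

all-dec : ∀ {A _≈_} → Exhaustible A _≈_ → Symmetric _≈_ →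
  (P : Pred A 0ℓ) → Decidable P → P Respects _≈_ → Dec (∀ x → P x)
all-dec ex ≈-sym P P? resp
  with ex (¬_ ∘ P) (¬? ∘ P?) (λ e ¬px py → ¬px (resp (≈-sym e) py))
... | yes (x , ¬px) = no λ all → ¬px (all x)
... | no ¬∃         = yes λ x → decidable-stable (P? x) λ ¬px → ¬∃ (x , ¬px)

exhaustible-Fin⇒ : ∀ a b → Exhaustible (Fin a → Fin b) _≗_
exhaustible-Fin⇒ a b = exhaustible-Π a (λ _ → refl) (λ _ → exhaustible-Fin)

exhaustible-Adj : ∀ m → Exhaustible (Adj m) _≐_
exhaustible-Adj m = exhaustible-Π m (λ _ _ → refl)
  (λ _ → exhaustible-Π m (λ _ → refl) (λ _ → exhaustible-Bool))

-- Whether some bijection Fin a ↔ Fin b has a property of its forward map is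
-- decidable: search for a forward map together with an inverse.
bijection-dec : ∀ {a b} (Q : Pred (Fin a → Fin b) 0ℓ) → Decidable Q → Q Respects _≗_ →
  Dec (Σ (Fin a ↔ Fin b) (Q ∘ Inverse.to))
bijection-dec {a} {b} Q Q? resp
  with exhaustible-Fin⇒ a b (λ f → ∃ λ g → Inverses f g × Q f)
         (λ f → exhaustible-Fin⇒ b a (λ g → Inverses f g × Q f) (λ g → inverses? f g ×-dec Q? f)
                  (λ e ((l , r) , q) → ((λ y → trans (cong f (sym (e y))) (l y)) ,
                                                 (λ x → trans (sym (e (f x))) (r x))) , q))
         (λ e (g , (l , r) , q) → g , ((λ y → trans (sym (e (g y))) (l y)) ,
                                                (λ x → trans (cong g (sym (e x))) (r x))) , resp e q)
  where
  Inverses : (Fin a → Fin b) → (Fin b → Fin a) → Set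
  Inverses f g = (∀ y → f (g y) ≡ y) × (∀ x → g (f x) ≡ x)
  inverses? : ∀ f g → Dec (Inverses f g)
  inverses? f g = Fin.all? (λ y → f (g y) Fin.≟ y) ×-dec Fin.all? (λ x → g (f x) Fin.≟ x)
... | yes (f , g , (l , r) , q) = yes (mk↔ₛ′ f g l r , q)
... | no ¬p = no λ (σ , q) →
  ¬p (Inverse.to σ , Inverse.from σ , (Inverse.strictlyInverseˡ σ , Inverse.strictlyInverseʳ σ) , q)

true⇒witness : ∀ {A : Set} (a? : Dec A) → does a? ≡ true → A
true⇒witness (yes a) _ = a

-- Iterating an inflationary operator on subsets of Fin m reaches a fixed
-- point: every non-stable step adds an element, which can happen at most m times.
iterate : ∀ {m} → ((Fin m → Bool) → (Fin m → Bool)) → (Fin m → Bool) → ℕ → Fin m → Bool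
iterate F S zero    = S
iterate F S (suc j) = F (iterate F S j)

Stable : ∀ {m} → ((Fin m → Bool) → (Fin m → Bool)) → (Fin m → Bool) → ℕ → Set
Stable F S i = F (iterate F S i) ⊆ᵇ iterate F S i

module _ {m} (F : (Fin m → Bool) → (Fin m → Bool)) (inflationary : ∀ S → S ⊆ᵇ F S) (S : Fin m → Bool) where

  private
    stable-or-grows : ∀ j → (∃ (Stable F S)) ⊎ (j ≤ card (iterate F S j))
    stable-or-grows zero = inj₂ z≤n
    stable-or-grows (suc j) with stable-or-grows j
    ... | inj₁ stable = inj₁ stable
    ... | inj₂ j≤card
      with Fin.any? (λ x → (F (iterate F S j) x Bool.≟ true) ×-dec (iterate F S j x Bool.≟ false))
    ... | yes (x , new , old) =
      inj₂ (≤-trans (s≤s j≤card) (card-strict (inflationary (iterate F S j)) x old new))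
    ... | no ¬new = inj₁ (j , stable)
      where
      stable : Stable F S j
      stable x e with iterate F S j x in old
      ... | true  = refl
      ... | false = ⊥-elim (¬new (x , e , old))

  fixpoint : ∃ (Stable F S)
  fixpoint with stable-or-grows (suc m)
  ... | inj₁ stable = stable
  ... | inj₂ m<card = ⊥-elim (1+n≰n (≤-trans m<card (card-≤ (iterate F S (suc m)))))

  iterate-grows : ∀ j → S ⊆ᵇ iterate F S j
  iterate-grows zero    x e = e
  iterate-grows (suc j) x e = inflationary _ x (iterate-grows j x e)

-- Reachability is decidable: the set of vertices reaching v is the fixed point
-- of "add every vertex with a neighbour in the set", started from {v}.
module Reachability (X : Graph) (v : Fin (n X)) where

  Expanded : (Fin (n X) → Bool) → Fin (n X) → Set
  Expanded S x = S x ≡ true ⊎ ∃ λ w → adj X x w ≡ true × S w ≡ true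

  expanded? : ∀ S x → Dec (Expanded S x)
  expanded? S x = (S x Bool.≟ true) ⊎-dec Fin.any? (λ w → (adj X x w Bool.≟ true) ×-dec (S w Bool.≟ true))

  expand : (Fin (n X) → Bool) → Fin (n X) → Bool
  expand S x = does (expanded? S x)

  expand-inflationary : ∀ S → S ⊆ᵇ expand S
  expand-inflationary S x e = dec-true (expanded? S x) (inj₁ e)

  stage : ℕ → Fin (n X) → Bool
  stage = iterate expand (single v)

  stage-sound : ∀ j x → stage j x ≡ true → Reach X x v
  stage-sound zero    x e rewrite single⇒≡ e = here
  stage-sound (suc j) x e with true⇒witness (expanded? (stage j) x) e
  ... | inj₁ old          = stage-sound j x old
  ... | inj₂ (w , xw , w∈) = step xw (stage-sound j w w∈)

  stable-complete : ∀ i → Stable expand (single v) i → ∀ {x} → Reach X x v → stage i x ≡ true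
  stable-complete i stable here = iterate-grows expand expand-inflationary (single v) i v (single-self v)
  stable-complete i stable (step {x} {w} xw r) =
    stable x (dec-true (expanded? (stage i) x) (inj₂ (w , xw , stable-complete i stable r)))

  reach? : ∀ x → Dec (Reach X x v)
  reach? x with fixpoint expand expand-inflationary (single v)
  ... | i , stable with stage i x in e
  ... | true  = yes (stage-sound i x e)
  ... | false = no λ r → true≢false (trans (sym (stable-complete i stable r)) e)

connected? : ∀ X → Dec (Connected X)
connected? X = (0 <? n X) ×-dec Fin.all? (λ u → Fin.all? (λ v → Reachability.reach? X v u))

iso? : ∀ X Y → Dec (Iso X Y)
iso? X Y = bijection-dec (λ f → ∀ u v → adj Y (f u) (f v) ≡ adj X u v)
  (λ f → Fin.all? λ u → Fin.all? λ v → adj Y (f u) (f v) Bool.≟ adj X u v)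
  (λ e h u v → trans (cong₂ (adj Y) (sym (e u)) (sym (e v))) (h u v))

simple? : ∀ X → Dec (SimpleGraph X)
simple? X = (Fin.all? λ u → Fin.all? λ v → adj X u v Bool.≟ adj X v u) ×-dec
            (Fin.all? λ v → adj X v v Bool.≟ false)

unigraph? : ∀ X → Dec (Unigraph X)
unigraph? X with all-dec (exhaustible-Adj (n X)) ≐-sym _ candidate? respects
  where
  Candidate : Adj (n X) → Set
  Candidate A = SimpleGraph (mkGraph (n X) A) → (∀ v → deg (mkGraph (n X) A) v ≡ deg X v) →
    Iso X (mkGraph (n X) A)
  candidate? : ∀ A → Dec (Candidate A)
  candidate? A = simple? _ →-dec
    (Fin.all? (λ v → deg (mkGraph (n X) A) v ℕ.≟ deg X v) →-dec iso? X (mkGraph (n X) A))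
  respects : ∀ {A B} → A ≐ B → Candidate A → Candidate B
  respects {A} {B} e h simpleB degB = iso-trans {X} {mkGraph (n X) A} {mkGraph (n X) B}
    (h (simple-≐ (≐-sym e) simpleB) (λ v → trans (count-cong (e v)) (degB v))) (iso-≐ e)
... | yes u  = yes (unigraphOn⇒unigraph X u)
... | no ¬u = no λ u → ¬u (unigraph⇒unigraphOn X u)

colourAdj : ∀ {k} (X : Graph) → Coloring X k → Fin k → Adj (n X)
colourAdj X c i a b = colHit (adj X a b) (col c a b) i

colHit-≡ : ∀ {k} {b₁ b₂} {f : T b₁ → Fin k} {g : T b₂ → Fin k} →
  b₁ ≡ b₂ → (∀ p q → f p ≡ g q) → ∀ i → colHit b₁ f i ≡ colHit b₂ g i
colHit-≡ {b₁ = false} refl e i = refl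
colHit-≡ {b₁ = true}  refl e i = cong (λ j → ⌊ j ≟ i ⌋) (e tt tt)

colHit-true : ∀ {k} b (f : T b → Fin k) {i} → colHit b f i ≡ true → Σ (T b) λ p → f p ≡ i
colHit-true true f e = tt , single⇒≡ e

colHit-intro : ∀ {k} b (f : T b → Fin k) {i} → b ≡ true → (∀ p → f p ≡ i) → colHit b f i ≡ true
colHit-intro true f {i} refl h rewrite h tt = single-self i

colHit-absent : ∀ {k} b (f : T b → Fin k) i → b ≡ false → colHit b f i ≡ false
colHit-absent false f i refl = refl

colHit-determines : ∀ {k} b₁ b₂ (f : T b₁ → Fin k) (g : T b₂ → Fin k) →
  (∀ i → colHit b₁ f i ≡ colHit b₂ g i) → b₁ ≡ b₂
colHit-determines false false f g h = refl
colHit-determines true  true  f g h = refl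
colHit-determines true  false f g h with trans (sym (single-self (f tt))) (h (f tt))
... | ()
colHit-determines false true  f g h with trans (sym (single-self (g tt))) (sym (h (g tt)))
... | ()

colourAdj-simple : ∀ {k} (X : Graph) → SimpleGraph X → (c : Coloring X k) → ∀ i →
  SimpleGraph (mkGraph (n X) (colourAdj X c i))
colourAdj-simple X (symm , loopless) c i =
  (λ a b → colHit-≡ (symm a b) (col-sym c a b) i) ,
  (λ a → colHit-absent (adj X a a) (col c a a) i (loopless a))

_≈ᶜ_ : ∀ {k} {X : Graph} → Coloring X k → Coloring X k → Set
c ≈ᶜ c′ = ∀ u v p → col c u v p ≡ col c′ u v p

colourAdj-≈ : ∀ {k} (X : Graph) {c c′ : Coloring X k} → c ≈ᶜ c′ →
  ∀ i → colourAdj X c i ≐ colourAdj X c′ i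
colourAdj-≈ X {c} {c′} e i a b =
  colHit-≡ refl (λ p q → trans (e a b p) (cong (col c′ a b) (T-irrelevant p q))) i

induced : ∀ {m} → List (Fin m) → Adj m → Graph
induced vs A = mkGraph (length vs) (λ a b → A (lookup vs a) (lookup vs b))

induced-cong : ∀ {m} {vs ws : List (Fin m)} {A B : Adj m} → vs ≡ ws → A ≐ B →
  Iso (induced vs A) (induced ws B)
induced-cong refl e = ↔-refl , λ a b → sym (e _ _)

colorSubgraph-≈ : ∀ {k} (X : Graph) {c c′ : Coloring X k} → c ≈ᶜ c′ → ∀ i →
  Iso (colorSubgraph X c i) (colorSubgraph X c′ i)
colorSubgraph-≈ {k} X {c} {c′} e i =
  induced-cong (filter-≐ (T? ∘ incident c) (T? ∘ incident c′) same-vertices (allFin (n X)))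
               (colourAdj-≈ X {c} {c′} e i)
  where
  incident : Coloring X k → Fin (n X) → Bool
  incident d v = any (colourAdj X d i v) (allFin (n X))
  same-row : ∀ v → incident c v ≡ incident c′ v
  same-row v = cong or (map-cong (colourAdj-≈ X {c} {c′} e i v) (allFin (n X)))
  same-vertices : (T ∘ incident c) Relation.Unary.≐ (T ∘ incident c′)
  same-vertices = (λ {v} → subst T (same-row v)) , (λ {v} → subst T (sym (same-row v)))

-- Colourings of a fixed graph form an exhaustible type: search all maps
-- assigning a colour to every edge, keeping the symmetric ones.
module _ (X : Graph) (k : ℕ) where

  private
    EdgeColours : Set
    EdgeColours = (u v : Fin (n X)) → T (adj X u v) → Fin k

    SymmetricColours : EdgeColours → Set
    SymmetricColours F = ∀ u v p q → F u v p ≡ F v u q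

    agree? : ∀ {b b′} (f : T b → Fin k) (g : T b′ → Fin k) → Dec (∀ p q → f p ≡ g q)
    agree? {false}         f g = yes λ ()
    agree? {true} {false}  f g = yes λ _ ()
    agree? {true} {true}   f g = map′ (λ { e tt tt → e }) (λ h → h tt tt) (f tt Fin.≟ g tt)

    symmetric? : ∀ F → Dec (SymmetricColours F)
    symmetric? F = Fin.all? λ u → Fin.all? λ v → agree? (F u v) (F v u)

  exhaustible-Coloring : Exhaustible (Coloring X k) _≈ᶜ_
  exhaustible-Coloring P P? resp
    with exhaustible-Π (n X) (λ _ _ _ → refl)
           (λ u → exhaustible-Π (n X) (λ _ _ → refl) (λ v → exhaustible-T⇒ (adj X u v) exhaustible-Fin))
           (λ F → Σ (SymmetricColours F) (P ∘ mkColoring F)) good? respects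
    where
    good? : ∀ F → Dec (Σ (SymmetricColours F) (P ∘ mkColoring F))
    good? F with symmetric? F
    ... | no ¬s = no (¬s ∘ proj₁)
    ... | yes s with P? (mkColoring F s)
    ...   | yes p = yes (s , p)
    ...   | no ¬p = no λ (s′ , p) → ¬p (resp (λ _ _ _ → refl) p)
    respects : ∀ {F F′} → (∀ u v p → F u v p ≡ F′ u v p) →
      Σ (SymmetricColours F) (P ∘ mkColoring F) → Σ (SymmetricColours F′) (P ∘ mkColoring F′)
    respects e (s , p) = (λ u v p q → trans (sym (e u v p)) (trans (s u v p q) (e v u q))) , resp e p
  ... | yes (F , s , p) = yes (mkColoring F s , p)
  ... | no ¬p = no λ (c , p) → ¬p (col c , col-sym c , resp (λ _ _ _ → refl) p)

unigraphic-≈ : ∀ {k} (X : Graph) {c c′ : Coloring X k} → c ≈ᶜ c′ → Unigraphic X c → Unigraphic X c′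
unigraphic-≈ X {c} {c′} e u i =
  connected-iso (colorSubgraph-≈ X {c} {c′} e i) (proj₁ (u i)) ,
  unigraph-iso {colorSubgraph X c i} {colorSubgraph X c′ i} (colorSubgraph-≈ X {c} {c′} e i) (proj₂ (u i))

unigraphic? : ∀ {k} (X : Graph) (c : Coloring X k) → Dec (Unigraphic X c)
unigraphic? X c = Fin.all? λ i → connected? (colorSubgraph X c i) ×-dec unigraph? (colorSubgraph X c i)

isKUnigraph? : ∀ G k → Dec (IsKUnigraph G k)
isKUnigraph? G k = exhaustible-Coloring G k (Unigraphic G) (unigraphic? G) (λ {c} {c′} → unigraphic-≈ G {c} {c′})

Rigid : ∀ {k} (G : Graph) → Coloring G k → Set
Rigid {k} G c = ∀ H → SimpleGraph H → (c′ : Coloring H k) → SameColDegrees G c H c′ → Iso G H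

RigidOn : ∀ {k} (G : Graph) → Coloring G k → Set
RigidOn {k} G c = ∀ (A : Adj (n G)) → SimpleGraph (mkGraph (n G) A) →
  (Σ (Coloring (mkGraph (n G) A) k) λ c′ → ∀ v i → cdeg (mkGraph (n G) A) c′ v i ≡ cdeg G c v i) →
  Iso G (mkGraph (n G) A)

relabel-coloring : ∀ {k m} (H : Graph) (σ : Fin m ↔ Fin (n H)) → Coloring H k → Coloring (relabel H σ) k
relabel-coloring H σ c = mkColoring (λ a b → col c (Inverse.to σ a) (Inverse.to σ b)) (λ a b → col-sym c _ _)

cdeg-relabel : ∀ {k m} (H : Graph) (σ : Fin m ↔ Fin (n H)) (c : Coloring H k) → ∀ v i →
  cdeg (relabel H σ) (relabel-coloring H σ c) v i ≡ cdeg H c (Inverse.to σ v) i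
cdeg-relabel H σ c v i = begin
  count (row ∘ Inverse.to σ) ≡⟨ count≡card (row ∘ Inverse.to σ) ⟩
  card (row ∘ Inverse.to σ)  ≡⟨ card-permute σ row ⟩
  card row                   ≡⟨ count≡card row ⟨
  count row                  ∎
  where
  open ≡-Reasoning
  row = colourAdj H c i (Inverse.to σ v)

rigidOn⇒rigid : ∀ {k} (G : Graph) (c : Coloring G k) → RigidOn G c → Rigid G c
rigidOn⇒rigid G c r H simpleH c′ (σ , d) =
  iso-trans {G} {relabel H σ} {H}
    (r _ (relabel-simple H σ simpleH) (relabel-coloring H σ c′ , λ v i → trans (cdeg-relabel H σ c′ v i) (d v i)))
    (relabel-iso H σ)

rigid⇒rigidOn : ∀ {k} (G : Graph) (c : Coloring G k) → Rigid G c → RigidOn G c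
rigid⇒rigidOn G c r A simpleA (c′ , d) = r _ simpleA c′ (↔-refl , d)

transport-coloring : ∀ {k m} {A B : Adj m} → A ≐ B → Coloring (mkGraph m B) k → Coloring (mkGraph m A) k
transport-coloring e c = mkColoring (λ u v p → col c u v (subst T (e u v) p)) (λ u v p q → col-sym c u v _ _)

colourAdj-transport : ∀ {k m} {A B : Adj m} (e : A ≐ B) (c : Coloring (mkGraph m B) k) → ∀ i →
  colourAdj (mkGraph m A) (transport-coloring e c) i ≐ colourAdj (mkGraph m B) c i
colourAdj-transport e c i u v = colHit-≡ (e u v) (λ p q → cong (col c u v) (T-irrelevant _ _)) i

rigid? : ∀ {k} (G : Graph) (c : Coloring G k) → Dec (Rigid G c)
rigid? {k} G c with all-dec (exhaustible-Adj (n G)) ≐-sym _ candidate? respects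
  where
  Matching : (A : Adj (n G)) → Coloring (mkGraph (n G) A) k → Set
  Matching A c′ = ∀ v i → cdeg (mkGraph (n G) A) c′ v i ≡ cdeg G c v i
  matching? : ∀ A → Dec (Σ (Coloring (mkGraph (n G) A) k) (Matching A))
  matching? A = exhaustible-Coloring (mkGraph (n G) A) k (Matching A)
    (λ c′ → Fin.all? λ v → Fin.all? λ i → cdeg (mkGraph (n G) A) c′ v i ℕ.≟ cdeg G c v i)
    (λ {c₁} {c₂} e h v i →
       trans (count-cong (λ u → sym (colourAdj-≈ (mkGraph (n G) A) {c₁} {c₂} e i v u))) (h v i))
  Candidate : Adj (n G) → Set
  Candidate A = SimpleGraph (mkGraph (n G) A) → Σ (Coloring (mkGraph (n G) A) k) (Matching A) →
    Iso G (mkGraph (n G) A)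
  candidate? : ∀ A → Dec (Candidate A)
  candidate? A = simple? _ →-dec (matching? A →-dec iso? G (mkGraph (n G) A))
  respects : ∀ {A B} → A ≐ B → Candidate A → Candidate B
  respects {A} {B} e h simpleB (c′ , d) = iso-trans {G} {mkGraph (n G) A} {mkGraph (n G) B}
    (h (simple-≐ (≐-sym e) simpleB)
       (transport-coloring e c′ , λ v i → trans (count-cong (colourAdj-transport e c′ i v)) (d v i)))
    (iso-≐ e)
... | yes r  = yes (rigidOn⇒rigid G c r)
... | no ¬r = no λ r → ¬r (rigid⇒rigidOn G c r)

stronglyUnigraphic-≈ : ∀ {k} (X : Graph) {c c′ : Coloring X k} → c ≈ᶜ c′ →
  StronglyUnigraphic X c → StronglyUnigraphic X c′
stronglyUnigraphic-≈ X {c} {c′} e (u , r) = unigraphic-≈ X {c} {c′} e u ,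
  λ H simpleH c″ (σ , d) → r H simpleH c″
    (σ , λ v i → trans (d v i) (count-cong (λ u → sym (colourAdj-≈ X {c} {c′} e i v u))))

isKStrongUnigraph? : ∀ G k → Dec (IsKStrongUnigraph G k)
isKStrongUnigraph? G k = exhaustible-Coloring G k (StronglyUnigraphic G)
  (λ c → unigraphic? G c ×-dec rigid? G c) (λ {c} {c′} → stronglyUnigraphic-≈ G {c} {c′})

record IsStar {m} (E : Adj m) (x : Fin m) (S : Fin m → Bool) : Set where
  field
    centre-row    : ∀ b → E x b ≡ S b
    leaf-row      : ∀ a → S a ≡ true → ∀ b → E a b ≡ single x b
    other-row     : ∀ a → S a ≡ false → a ≢ x → ∀ b → E a b ≡ false

bool-ext : ∀ {a b} → (a ≡ true → b ≡ true) → (b ≡ true → a ≡ true) → a ≡ b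
bool-ext f g = ⇔→≡ (mk⇔ f g)

star-unique : ∀ {m} {E E′ : Adj m} {x S} → IsStar E x S → IsStar E′ x S → E ≐ E′
star-unique {x = x} {S} st st′ a b with a ≟ x
... | yes refl = trans (IsStar.centre-row st b) (sym (IsStar.centre-row st′ b))
... | no a≢x with S a in sa
...   | true  = trans (IsStar.leaf-row st a sa b) (sym (IsStar.leaf-row st′ a sa b))
...   | false = trans (IsStar.other-row st a sa a≢x b) (sym (IsStar.other-row st′ a sa a≢x b))

-- The centre's neighbours must be
-- leaves (other vertices have degree 0), hence all leaves by counting; a leaf
-- has degree 1 and is adjacent to the centre, so to nothing else.
star-rigid : ∀ {m} {E E′ : Adj m} {x S} → IsStar E x S → SimpleGraph (mkGraph m E′) →
  (∀ a → card (E′ a) ≡ card (E a)) → IsStar E′ x S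
star-rigid {m} {E} {E′} {x} {S} st (symm , loopless) degrees = record
  { centre-row    = λ b → bool-ext (neighbour⇒leaf b) (leaf⇒neighbour b)
  ; leaf-row      = leaf-row
  ; other-row     = λ a sa a≢x → card-0⇒false (E′ a) (other-degree a sa a≢x)
  }
  where
  centre-degree : card (E′ x) ≡ card S
  centre-degree = trans (degrees x) (card-cong (IsStar.centre-row st))
  leaf-degree : ∀ a → S a ≡ true → card (E′ a) ≡ 1
  leaf-degree a sa = trans (degrees a) (trans (card-cong (IsStar.leaf-row st a sa)) (card-single x))
  other-degree : ∀ a → S a ≡ false → a ≢ x → card (E′ a) ≡ 0
  other-degree a sa a≢x = trans (degrees a) (card-false (E a) (IsStar.other-row st a sa a≢x))

  neighbour⇒leaf : E′ x ⊆ᵇ S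
  neighbour⇒leaf w e with S w in sw | w ≟ x
  ... | true  | _        = refl
  ... | false | yes refl = ⊥-elim (true≢false (trans (sym e) (loopless x)))
  ... | false | no w≢x   = ⊥-elim (true≢false (trans (sym e)
                             (trans (symm x w) (card-0⇒false (E′ w) (other-degree w sw w≢x) x))))
  leaf⇒neighbour : S ⊆ᵇ E′ x
  leaf⇒neighbour = card-⊆-≡ neighbour⇒leaf centre-degree

  leaf-row : ∀ a → S a ≡ true → ∀ b → E′ a b ≡ single x b
  leaf-row a sa b = bool-ext only-centre (single-⊆ a~x b)
    where
    a~x : E′ a x ≡ true
    a~x = trans (symm a x) (leaf⇒neighbour a sa)
    only-centre : E′ a b ≡ true → single x b ≡ true
    only-centre e rewrite card-1-unique (E′ a) (leaf-degree a sa) a~x e = single-self x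

star-unigraph : ∀ {m} {E : Adj m} {x S} → IsStar E x S → Unigraph (mkGraph m E)
star-unigraph {m} {E} st = unigraphOn⇒unigraph (mkGraph m E) λ A simpleA degrees →
  iso-≐ (star-unique st (star-rigid st simpleA λ a →
    trans (sym (count≡card (A a))) (trans (degrees a) (count≡card (E a)))))

star-connected : ∀ {m} {E : Adj m} {x S} → IsStar E x S → (∀ a → S a ≡ true ⊎ a ≡ x) →
  Connected (mkGraph m E)
star-connected {m} {E} {x} {S} st spanning =
  inhabited⇒positive x , λ a b → via-centre (to-centre a) (from-centre b)
  where
  to-centre : ∀ a → Reach (mkGraph m E) a x
  to-centre a with spanning a
  ... | inj₂ refl = here
  ... | inj₁ sa   = step (trans (IsStar.leaf-row st a sa x) (single-self x)) here
  from-centre : ∀ b → Reach (mkGraph m E) x b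
  from-centre b with spanning b
  ... | inj₂ refl = here
  ... | inj₁ sb   = step (trans (IsStar.centre-row st b) sb) here
  via-centre : ∀ {a b} → Reach (mkGraph m E) a x → Reach (mkGraph m E) x b → Reach (mkGraph m E) a b
  via-centre here       r = r
  via-centre (step e w) r = step e (via-centre w r)

star-restrict : ∀ {m k} {E : Adj m} {x S} → IsStar E x S → (f : Fin k → Fin m) → Injective _≡_ _≡_ f →
  ∀ {x′} → f x′ ≡ x → IsStar (λ a b → E (f a) (f b)) x′ (S ∘ f)
star-restrict {E = E} {x} {S} st f f-inj {x′} fx′≡x = record
  { centre-row    = λ b → trans (cong (λ y → E y (f b)) fx′≡x) (IsStar.centre-row st (f b))
  ; leaf-row      = λ a sa b → trans (IsStar.leaf-row st (f a) sa (f b)) (single-image b)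
  ; other-row     = λ a sa a≢x′ → IsStar.other-row st (f a) sa (a≢x′ ∘ hits-centre) ∘ f
  }
  where
  hits-centre : ∀ {b} → f b ≡ x → b ≡ x′
  hits-centre e = f-inj (trans e (sym fx′≡x))
  single-image : ∀ b → single x (f b) ≡ single x′ b
  single-image b = trans (isYes≗does (f b ≟ x))
    (trans (does-⇔ (mk⇔ hits-centre (λ { refl → fx′≡x })) (f b ≟ x) (b ≟ x′)) (sym (isYes≗does (b ≟ x′))))

centred⇒star : ∀ {m} {E : Adj m} {x} → SimpleGraph (mkGraph m E) →
  (∀ a b → E a b ≡ true → a ≡ x ⊎ b ≡ x) → IsStar E x (E x)
centred⇒star {m} {E} {x} (symm , loopless) centred = record
  { centre-row    = λ _ → refl
  ; leaf-row      = λ a x~a b → bool-ext (leaf-edge a x~a b) (single-⊆ (trans (symm a x) x~a) b)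
  ; other-row     = other-row
  }
  where
  leaf-edge : ∀ a → E x a ≡ true → ∀ b → E a b ≡ true → single x b ≡ true
  leaf-edge a x~a b e with centred a b e
  ... | inj₂ refl = single-self x
  ... | inj₁ refl = ⊥-elim (true≢false (trans (sym x~a) (loopless x)))
  other-row : ∀ a → E x a ≡ false → a ≢ x → ∀ b → E a b ≡ false
  other-row a x≁a a≢x b with E a b in e
  ... | false = refl
  ... | true with centred a b e
  ...   | inj₁ a≡x  = ⊥-elim (a≢x a≡x)
  ...   | inj₂ refl = ⊥-elim (true≢false (trans (sym e) (trans (symm a x) x≁a)))

lookup-injective : ∀ {A : Set} {xs : List A} → Unique xs → Injective _≡_ _≡_ (lookup xs)
lookup-injective (x∉ ∷ u) {zero}  {zero}  e = refl
lookup-injective (x∉ ∷ u) {zero}  {suc j} e = ⊥-elim (All.lookup x∉ (∈-lookup j) e)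
lookup-injective (x∉ ∷ u) {suc i} {zero}  e = ⊥-elim (All.lookup x∉ (∈-lookup i) (sym e))
lookup-injective (x∉ ∷ u) {suc i} {suc j} e = cong suc (lookup-injective u e)

module Enumeration {m} {P : Pred (Fin m) 0ℓ} (P? : Decidable P) where

  members : List (Fin m)
  members = filter P? (allFin m)

  size : ℕ
  size = length members

  element : Fin size → Fin m
  element = lookup members

  element-injective : Injective _≡_ _≡_ element
  element-injective = lookup-injective (Unique.filter⁺ P? (Unique.allFin⁺ m))

  element-satisfies : ∀ j → P (element j)
  element-satisfies j = proj₂ (∈-filter⁻ P? {xs = allFin m} (∈-lookup j))

  position : ∀ x → P x → Fin size
  position x px = Any.index (∈-filter⁺ P? (∈-allFin x) px)

  element-position : ∀ x (px : P x) → element (position x px) ≡ x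
  element-position x px = sym (lookup-index (∈-filter⁺ P? (∈-allFin x) px))

  position-element : ∀ j (p : P (element j)) → position (element j) p ≡ j
  position-element j p = element-injective (element-position (element j) p)

  size≡card : size ≡ card (λ x → does (P? x))
  size≡card = length-filter-tabulate P? id

module StarColouring (G : Graph) (simpleG : SimpleGraph G) (U : Subset (n G))
  (cover : VertexCover G U)
  (private-neighbour : ∀ u → u ∈ U → ∃ λ y → adj G u y ≡ true × y ∉ U) where

  open Min (Fin.≤-totalOrder (n G)) using (_⊓_; ⊓-comm; ⊓-sel)
  open Enumeration (_∈? U) using (size; element; element-injective; element-satisfies;
    position; element-position; position-element; size≡card)

  -- The endpoint of an edge uv that will be the centre of its colour class.
  edge-centre : Fin (n G) → Fin (n G) → Fin (n G)
  edge-centre u v with u ∈? U | v ∈? U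
  ... | yes _ | yes _ = u ⊓ v
  ... | yes _ | no _  = u
  ... | no _  | _     = v

  edge-centre-comm : ∀ u v → u ∈ U ⊎ v ∈ U → edge-centre u v ≡ edge-centre v u
  edge-centre-comm u v covered with u ∈? U | v ∈? U
  ... | yes _ | yes _ = ⊓-comm u v
  ... | yes _ | no _  = refl
  ... | no _  | yes _ = refl
  ... | no u∉ | no v∉ with covered
  ...   | inj₁ u∈ = ⊥-elim (u∉ u∈)
  ...   | inj₂ v∈ = ⊥-elim (v∉ v∈)

  edge-centre∈U : ∀ u v → u ∈ U ⊎ v ∈ U → edge-centre u v ∈ U
  edge-centre∈U u v covered with u ∈? U | v ∈? U
  ... | yes u∈ | yes v∈ with ⊓-sel u v
  ...   | inj₁ e = subst (_∈ U) (sym e) u∈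
  ...   | inj₂ e = subst (_∈ U) (sym e) v∈
  edge-centre∈U u v covered | yes u∈ | no _ = u∈
  edge-centre∈U u v covered | no _   | yes v∈ = v∈
  edge-centre∈U u v covered | no u∉  | no v∉ with covered
  ...   | inj₁ u∈ = ⊥-elim (u∉ u∈)
  ...   | inj₂ v∈ = ⊥-elim (v∉ v∈)

  edge-centre-endpoint : ∀ u v → edge-centre u v ≡ u ⊎ edge-centre u v ≡ v
  edge-centre-endpoint u v with u ∈? U | v ∈? U
  ... | yes _ | yes _ = ⊓-sel u v
  ... | yes _ | no _  = inj₁ refl
  ... | no _  | _     = inj₂ refl

  edge-centre-private : ∀ u v → u ∈ U → v ∉ U → edge-centre u v ≡ u
  edge-centre-private u v u∈ v∉ with u ∈? U | v ∈? U
  ... | yes _ | no _  = refl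
  ... | yes _ | yes v∈ = ⊥-elim (v∉ v∈)
  ... | no u∉ | _      = ⊥-elim (u∉ u∈)

  private
    covered : ∀ {u v} → T (adj G u v) → u ∈ U ⊎ v ∈ U
    covered p = cover _ _ (Equivalence.to T-≡ p)

    position-cong : ∀ {x y} (px : x ∈ U) (py : y ∈ U) → x ≡ y → position x px ≡ position y py
    position-cong px py refl = element-injective (trans (element-position _ px) (sym (element-position _ py)))

  colour : (u v : Fin (n G)) → T (adj G u v) → Fin size
  colour u v p = position (edge-centre u v) (edge-centre∈U u v (covered p))

  starColouring : Coloring G size
  starColouring = mkColoring colour λ u v p q → position-cong _ _ (edge-centre-comm u v (covered p))

  colours≡∣U∣ : size ≡ ∣ U ∣
  colours≡∣U∣ = trans size≡card (sym (∣∣≡card U))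

  class : Fin size → Adj (n G)
  class = colourAdj G starColouring

  class-centred : ∀ j a b → class j a b ≡ true → a ≡ element j ⊎ b ≡ element j
  class-centred j a b e with colHit-true (adj G a b) (col starColouring a b) e
  ... | p , colour≡j = Sum.map (λ e′ → trans (sym e′) centre≡) (λ e′ → trans (sym e′) centre≡)
                               (edge-centre-endpoint a b)
    where
    centre≡ : edge-centre a b ≡ element j
    centre≡ = trans (sym (element-position _ _)) (cong element colour≡j)

  class-star : ∀ j → IsStar (class j) (element j) (class j (element j))
  class-star j = centred⇒star (colourAdj-simple G simpleG starColouring j) (class-centred j)

  class-leaf : ∀ j → ∃ λ y → class j (element j) y ≡ true
  class-leaf j with private-neighbour (element j) (element-satisfies j)
  ... | y , c~y , y∉U = y , colHit-intro (adj G (element j) y) (col starColouring (element j) y) c~y λ p →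
    trans (position-cong _ c∈U (edge-centre-private (element j) y c∈U y∉U)) (position-element j c∈U)
    where
    c∈U = element-satisfies j

  -- The colour-j subgraph is the star at c_j restricted to its non-isolated
  -- vertices, i.e. to c_j and its leaves: a connected unigraph.
  module ColourSubgraph (j : Fin size) where

    private
      incident : Fin (n G) → Bool
      incident v = any (class j v) (allFin (n G))

    open Enumeration (T? ∘ incident) using () renaming
      (element to vertex; element-injective to vertex-injective; element-satisfies to vertex-incident;
       position to index; element-position to vertex-index)

    centre-incident : T (incident (element j))
    centre-incident with class-leaf j
    ... | y , c~y = any⁺ (class j (element j)) (lose (∈-allFin y) (Equivalence.from T-≡ c~y))

    centre : Fin _
    centre = index (element j) centre-incident

    star : IsStar (adj (colorSubgraph G starColouring j)) centre (class j (element j) ∘ vertex)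
    star = star-restrict (class-star j) vertex vertex-injective (vertex-index _ centre-incident)

    -- Every vertex of the subgraph has an edge of colour j, so it is c_j or a leaf.
    spanning : ∀ a → class j (element j) (vertex a) ≡ true ⊎ a ≡ centre
    spanning a with class j (element j) (vertex a) in leaf | vertex a Fin.≟ element j
    ... | true  | _       = inj₁ refl
    ... | false | yes a≡c = inj₂ (vertex-injective (trans a≡c (sym (vertex-index _ centre-incident))))
    ... | false | no a≢c with satisfied (any⁻ (class j (vertex a)) (allFin (n G)) (vertex-incident a))
    ...   | u , a~u = ⊥-elim (true≢false (trans (sym (Equivalence.to T-≡ a~u))
                                                (IsStar.other-row (class-star j) (vertex a) leaf a≢c u)))

    connected : Connected (colorSubgraph G starColouring j)
    connected = star-connected star spanning

    unigraph : Unigraph (colorSubgraph G starColouring j)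
    unigraph = star-unigraph star

  unigraphic : Unigraphic G starColouring
  unigraphic j = ColourSubgraph.connected j , ColourSubgraph.unigraph j

  -- Rigidity: in a graph on the same vertices with the same coloured degrees,
  -- colour class j has the degrees of the star class j, hence is that star;
  -- since the colour classes determine the edges, the graph is G itself.
  matching-class : ∀ {A} → SimpleGraph (mkGraph (n G) A) → (c′ : Coloring (mkGraph (n G) A) size) →
    (∀ v j → cdeg (mkGraph (n G) A) c′ v j ≡ cdeg G starColouring v j) →
    ∀ j → colourAdj (mkGraph (n G) A) c′ j ≐ class j
  matching-class {A} simpleA c′ degrees j =
    star-unique (star-rigid (class-star j) (colourAdj-simple _ simpleA c′ j) same-degrees) (class-star j)
    where
    same-degrees : ∀ v → card (colourAdj (mkGraph (n G) A) c′ j v) ≡ card (class j v)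
    same-degrees v = trans (sym (count≡card (colourAdj (mkGraph (n G) A) c′ j v)))
                           (trans (degrees v j) (count≡card (class j v)))

  rigid : Rigid G starColouring
  rigid = rigidOn⇒rigid G starColouring λ A simpleA (c′ , degrees) →
    ↔-refl , λ u v → colHit-determines (A u v) (adj G u v) _ _ (λ j → matching-class simpleA c′ degrees j u v)

  stronglyUnigraphic : StronglyUnigraphic G starColouring
  stronglyUnigraphic = unigraphic , rigid

minimum : (P : ℕ → Set) → (∀ k → Dec (P k)) → ∀ {b} → P b → ∃ (IsMinimum P)
minimum P P? {b} pb with search (suc b)
  where
  search : ∀ j → (∀ k → k < j → ¬ P k) ⊎ ∃ (IsMinimum P)
  search zero = inj₁ λ k ()
  search (suc j) with search j
  ... | inj₂ found = inj₂ found
  ... | inj₁ none with P? j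
  ...   | yes pj = inj₂ (j , pj , λ k pk → ≮⇒≥ λ k<j → none k k<j pk)
  ...   | no ¬pj = inj₁ λ k k<1+j → below k (m<1+n⇒m<n∨m≡n k<1+j)
    where
    below : ∀ k → k < j ⊎ k ≡ j → ¬ P k
    below k (inj₁ k<j) = none k k<j
    below k (inj₂ refl) = ¬pj
... | inj₁ none  = ⊥-elim (none b (n<1+n b) pb)
... | inj₂ found = found

vertexCover? : ∀ G t → Dec (HasVertexCoverOfSize G t)
vertexCover? G t = anySubset? λ U →
  (Fin.all? λ u → Fin.all? λ v → (adj G u v Bool.≟ true) →-dec ((u ∈? U) ⊎-dec (v ∈? U))) ×-dec
  (∣ U ∣ ℕ.≟ t)

full-cover : ∀ G → HasVertexCoverOfSize G (n G)
full-cover G = ⊤ , (λ u v _ → inj₁ ∈⊤) , ∣⊤∣≡n (n G)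

-- In a smallest vertex cover U every u ∈ U has a neighbour outside U:
-- otherwise U - u would be a smaller cover.
smallest-cover⇒private-neighbours : ∀ G → SimpleGraph G → ∀ {U} → VertexCover G U →
  (∀ k → HasVertexCoverOfSize G k → ∣ U ∣ ≤ k) → ∀ u → u ∈ U → ∃ λ y → adj G u y ≡ true × y ∉ U
smallest-cover⇒private-neighbours G (symm , loopless) {U} cover smallest u u∈U
  with Fin.any? (λ y → (adj G u y Bool.≟ true) ×-dec ¬? (y ∈? U))
... | yes found = found
... | no none = ⊥-elim (1+n≰n (≤-trans (x∈p⇒∣p-x∣<∣p∣ u∈U) (smallest _ (U - u , smaller-cover , refl))))
  where
  neighbour∈U : ∀ y → adj G u y ≡ true → y ∈ U
  neighbour∈U y e with y ∈? U
  ... | yes y∈U = y∈U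
  ... | no  y∉U = ⊥-elim (none (y , e , y∉U))
  neighbour≢u : ∀ y → adj G u y ≡ true → y ≢ u
  neighbour≢u y e refl = true≢false (trans (sym e) (loopless u))
  keep : ∀ a b → adj G a b ≡ true → a ∈ U → a ∈ U - u ⊎ b ∈ U - u
  keep a b e a∈U with a Fin.≟ u
  ... | no a≢u  = inj₁ (x∈p∧x≢y⇒x∈p-y a∈U a≢u)
  ... | yes refl = inj₂ (x∈p∧x≢y⇒x∈p-y (neighbour∈U b e) (neighbour≢u b e))
  smaller-cover : VertexCover G (U - u)
  smaller-cover a b e with cover a b e
  ... | inj₁ a∈U = keep a b e a∈U
  ... | inj₂ b∈U = Sum.swap (keep b a (trans (symm b a) e) b∈U)

smallest-cover⇒strong : ∀ G → SimpleGraph G → ∀ {τ} → IsMinimum (HasVertexCoverOfSize G) τ →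
  IsKStrongUnigraph G τ
smallest-cover⇒strong G simpleG ((U , cover , refl) , smallest) =
  subst (IsKStrongUnigraph G) colours≡∣U∣ (starColouring , stronglyUnigraphic)
  where open StarColouring G simpleG U cover (smallest-cover⇒private-neighbours G simpleG cover smallest)

strong⇒unigraph : ∀ {G k} → IsKStrongUnigraph G k → IsKUnigraph G k
strong⇒unigraph (c , unigraphic , _) = c , unigraphic

-- The theorem: the three minima exist by search, each bounded by a witness
-- obtained from the next.
theorem1 : (G : Graph) → SimpleGraph G → Connected G →
    Σ ℕ λ w → Σ ℕ λ s → Σ ℕ λ τ →
      IsMinimum (IsKUnigraph G) w × IsMinimum (IsKStrongUnigraph G) s ×
      IsMinimum (HasVertexCoverOfSize G) τ × w ≤ s × s ≤ τ
theorem1 G simpleG _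
  with τ , min-τ ← minimum (HasVertexCoverOfSize G) (vertexCover? G) (full-cover G)
  with s , min-s ← minimum (IsKStrongUnigraph G) (isKStrongUnigraph? G)
                          (smallest-cover⇒strong G simpleG min-τ)
  with w , min-w ← minimum (IsKUnigraph G) (isKUnigraph? G) (strong⇒unigraph (proj₁ min-s))
  = w , s , τ , min-w , min-s , min-τ ,
    proj₂ min-w s (strong⇒unigraph (proj₁ min-s)) ,
    proj₂ min-s τ (smallest-cover⇒strong G simpleG min-τ)
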